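{- Let $M$ be a reachable marking of a t-net $N$. Then there is exactly one expanded pid-tree in $\mathit{repr}(M)$.
   Context: Process identifiers (pids). $\mathbb{P}=(\mathbb{N}^+)^*$ is the set of finite tuples of positive integers, including $\langle\rangle$, under concatenation; $\langle a_1,\dots,a_n\rangle$ is written $a_1.\cdots.a_n$. For $\pi=\langle a_1,\dots,a_n\rangle$: $\mathit{length}(\pi)=n$; $\mathit{prefix}(\pi)=\langle a_1,\dots,a_{n-1}\rangle$ if $n>0$, else $\langle\rangle$; $\mathit{subpid}(\pi)=\{\pi\}\cup\mathit{subpid}(\mathit{prefix}(\pi))$ if $n>0$, $\emptyset$ if $n=0$. $\mathbb P$ is ordered hierarchically: by length, then lexicographically. Coloured Petri nets and t-nets. Fix data values $\mathbb D\supseteq\mathbb N$ (disjoint from $\mathbb P$), variables $\mathbb V$, expressions $\mathbb E\supseteq\mathbb V\cup\mathbb D$; bindings are partial maps $\beta:\mathbb V\to\mathbb P\cup\mathbb D$ extended to expressions. A Petri net $(S,T,\ell)$ has finite disjoint places and transitions, place types $\ell(s)=X_1\times\dots\times X_k$ ($X_i\in\{\mathbb P,\mathbb D\}$), guards $\ell(t)\in\mathbb E$, arc labels $\ell(x,y)$ multisets over $\mathbb E$. A marking maps places to multisets of tokens of their type; $M\xrightarrow{t,\beta}M'$ iff $M(s)\ge\beta(\ell(s,t))$, $\beta(\ell(t,s))$ has type $\ell(s)$, $M'(s)=M(s)-\beta(\ell(s,t))+\beta(\ell(t,s))$ for all $s$, and $\beta(\ell(t))$ holds. A t-net additionally has: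 a unique generator place $s_\eta$ of type $\mathbb P\times\mathbb N$; initial marking with $M_0(s_\eta)=\{\langle\langle1\rangle,0\rangle\}$, other places empty or containing only data; for each $t$, $\ell(s_\eta,t)=\{\langle p_i,c_i\rangle:1\le i\le k\}$ (distinct variables) and $\ell(t,s_\eta)=\{\langle p_i,c_i+n_i\rangle:1\le i\le m\}\cup\{\langle p_i.(c_i+j),0\rangle:1\le i\le k,1\le j\le n_i\}$ ($m\le k$, $n_i\ge0$), $\Pi_t$ being the set of the $p_i.(c_i+j)$; arcs from $s\ne s_\eta$ carry vectors of variables and data values; arcs to $s\ne s_\eta$ carry vectors of expressions over data variables/values and elements of $\Pi_t\cup\{p_1,\dots,p_m\}$; guards are computable Boolean expressions in which pids are only compared by equality, parent, ancestor and younger-sibling relations. Reachable markings are reached from $M_0$ by finitely many firings. Pid-trees. $\Xi$ is the least set with $\langle M,C\rangle\in\Xi$ for a marking $M$ and $C=\langle\langle a_1,t_1\rangle,\dots,\langle a_n,t_n\rangle\rangle$, $t_i\in\Xi$, $a_i\in\mathbb P\setminus\{\langle\rangle\}$, for $i\ne j$: $a_i\ne a_j$, $a_i\notin\mathit{subpid}(a_j)$, $a_j\notin\mathit{subpid}(a_i)$; written $M\xrightarrow{a_1,\dots,a_n}\langle t_1,\dots,t_n\rangle$. Inclusion: $\langle M',\langle\langle a'_i,t'_i\rangle\rangle_{i\le m}\rangle\subseteq\langle M,\langle\langle a_j,t_j\rangle\rangle_{j\le n}\rangle$ iff $M'\le M$ and each $i$ has $j$ with $a'_i=a_j$, $t'_i\subseteq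 t_j$. Subtrees: $\langle\langle\rangle,t_0\rangle\in\mathit{Trees}(t_0)$ and $\langle a_i.\pi',t\rangle\in\mathit{Trees}(t_0)$ if $\langle\pi',t\rangle\in\mathit{Trees}(t_i)$; $\mathit{pid}(t)=\{\pi:\langle\pi,t'\rangle\in\mathit{Trees}(t)\}$. Path labelled $\pi$ decorated by $M'$: pid-tree $t$ with $\pi\in\mathit{pid}(t)\subseteq\mathit{subpid}(\pi)\cup\{\langle\rangle\}$, $\langle\pi,\langle M',\langle\rangle\rangle\rangle\in\mathit{Trees}(t)$, all other markings empty; "$R$ contains $\mathit{path}(\pi,M')$" means such a path is $\subseteq R$; $\mathit{path}(\pi)=\mathit{path}(\pi,\emptyset)$. Sibling ordered: $a_1\le\dots\le a_n$ (hierarchically) at every node. A pid-tree $T$ is expanded if for every $\langle\pi,t\rangle\in\mathit{Trees}(T)$ with $t=M\xrightarrow{a_1,\dots,a_n}\langle t_1,\dots,t_n\rangle$, $\mathit{length}(a_i)=1$ for all $i$. Representations. $\mathit{repr}(M)$: sibling ordered pid-trees $R$ built so that for each place $s$ of type $X_1\times\dots\times X_n$ and token $v=\langle x_1,\dots,x_n\rangle\in M(s)$ exactly one rule applies, and $R$ contains nothing beyond what the rules require (tokens with multiplicity): generator rule ($s=s_\eta$, $v=\langle\pi,i\rangle$): $R$ contains $\mathit{path}(\pi)$ and $\mathit{path}(\pi.(i+1))$; shared rule ($X_1=\mathbb D$): $R$ contains $\mathit{path}(\langle\rangle,\{(s,v)\})$ and $\mathit{path}(x_i)$ for every $X_i=\mathbb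 P$; owned rule ($X_1=\mathbb P$): $R$ contains $\mathit{path}(x_1,\{(s,v)\})$ and $\mathit{path}(x_i)$ for every $X_i=\mathbb P$. -}

module Defs where

open import Data.Nat using (ℕ; zero; suc; _+_; _<_; _≤_; _<ᵇ_; _≡ᵇ_; _≟_)
open import Data.Bool using (Bool; true; false; _∧_; not)
open import Data.Fin using (Fin; toℕ; inject≤) renaming (_≟_ to _≟F_)
open import Data.List using (List; []; _∷_; _++_; _∷ʳ_; map; concatMap; filter; length; allFin)
open import Data.List.Properties using (≡-dec)
open import Data.List.NonEmpty using (List⁺) renaming (toList to toList⁺)
open import Data.List.Relation.Unary.All using (All; []; _∷_)
open import Data.List.Relation.Unary.Any using (Any)
open import Data.List.Relation.Unary.AllPairs using (AllPairs)
open import Data.List.Relation.Unary.Linked using (Linked)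
open import Data.List.Relation.Binary.Pointwise using (Pointwise)
open import Data.List.Relation.Binary.Permutation.Propositional using (_↭_)
open import Data.List.Membership.Propositional using (_∈_)
open import Data.Product using (Σ; ∃; _×_; _,_; proj₁; proj₂)
open import Data.Sum using (_⊎_; inj₁; inj₂)
open import Relation.Nullary using (¬_; yes; no)
open import Relation.Binary.PropositionalEquality using (_≡_; _≢_; refl)

-- A pid is a finite tuple of naturals; the elements of ℙ = (ℕ⁺)* are the
-- tuples all of whose entries are positive (predicate IsPid).
Pid : Set
Pid = List ℕ

IsPid : Pid → Set
IsPid π = All (λ a → 0 < a) π

prefix : Pid → Pid
prefix []           = []
prefix (x ∷ [])     = []
prefix (x ∷ y ∷ xs) = x ∷ prefix (y ∷ xs)

data _∈subpid_ (ρ : Pid) : Pid → Set where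
  self : ∀ {x xs} → ρ ≡ x ∷ xs → ρ ∈subpid (x ∷ xs)
  up   : ∀ {x xs} → ρ ∈subpid prefix (x ∷ xs) → ρ ∈subpid (x ∷ xs)

data LexLeq : Pid → Pid → Set where
  []≤  : ∀ {b} → LexLeq [] b
  <≤   : ∀ {x y xs ys} → x < y → LexLeq (x ∷ xs) (y ∷ ys)
  ≡≤   : ∀ {x xs ys} → LexLeq xs ys → LexLeq (x ∷ xs) (x ∷ ys)

_≤H_ : Pid → Pid → Set
a ≤H b = length a < length b ⊎ (length a ≡ length b × LexLeq a b)

isPrefixB : Pid → Pid → Bool
isPrefixB []       _        = true
isPrefixB (_ ∷ _)  []       = false
isPrefixB (x ∷ xs) (y ∷ ys) = (x ≡ᵇ y) ∧ isPrefixB xs ys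

lastN : Pid → ℕ
lastN []           = 0
lastN (x ∷ [])     = x
lastN (x ∷ y ∷ xs) = lastN (y ∷ xs)

nonEmptyB : Pid → Bool
nonEmptyB []      = false
nonEmptyB (_ ∷ _) = true

data PRel : Set where
  equalR parentR ancestorR youngerSiblingR : PRel

-- relB r π π' : does π stand in relation r to π'?
--   equalR          : π = π'
--   parentR         : π is the parent of π'
--   ancestorR       : π is a (proper) ancestor of π'
--   youngerSiblingR : π is a younger sibling of π' (same parent, larger last index)
relB : PRel → Pid → Pid → Bool
relB equalR          π π' = isPrefixB π π' ∧ isPrefixB π' π
relB parentR         π π' = isPrefixB π π' ∧ (length π' ≡ᵇ suc (length π))
relB ancestorR       π π' = isPrefixB π π' ∧ (length π <ᵇ length π')
relB youngerSiblingR π π' =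
  nonEmptyB π ∧ nonEmptyB π' ∧ relB equalR (prefix π) (prefix π') ∧ (lastN π' <ᵇ lastN π)

data Ty : Set where
  P Dt : Ty

Val : Set → Ty → Set
Val D P  = Pid
Val D Dt = D

-- a token of a place of type X₁ × … × Xₙ
Tok : Set → List Ty → Set
Tok D tys = All (Val D) tys

pidComps : ∀ {D tys} → Tok D tys → List Pid
pidComps {tys = []}      []      = []
pidComps {tys = P ∷ _}   (x ∷ r) = x ∷ pidComps r
pidComps {tys = Dt ∷ _}  (_ ∷ r) = pidComps r

DataOnly : ∀ {D tys} → Tok D tys → Set
DataOnly {tys = tys} _ = All (_≡ Dt) tys

-- Transitions of a t-net
-- Variables of a transition: the generator variables p_i, c_i (i : Fin k),
-- further pid variables (Fin vp) and further data variables (Fin vd).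

data InComp (D : Set) (k vp vd : ℕ) : Ty → Set where
  genPid  : Fin k  → InComp D k vp vd P
  pidVar  : Fin vp → InComp D k vp vd P
  genCtr  : Fin k  → InComp D k vp vd Dt
  dataVar : Fin vd → InComp D k vp vd Dt
  dataVal : D      → InComp D k vp vd Dt

-- expressions over data variables and data values (semantically)
DataExp : Set → ℕ → ℕ → Set
DataExp D k vd = (Fin k → ℕ) → (Fin vd → D) → D

-- output arc components: data expressions, or pids in Π_t ∪ {p_1..p_m}
data OutComp (D : Set) (k m : ℕ) (n : Fin k → ℕ) (vd : ℕ) : Ty → Set where
  survivor : Fin m → OutComp D k m n vd P
  newPid   : (i : Fin k) → Fin (n i) → OutComp D k m n vd P -- p_i.(c_i + j), j = 1 + index
  dataExp  : DataExp D k vd → OutComp D k m n vd Dt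

-- guards: computable Boolean functions of the data variables and of the
-- equality/parent/ancestor/younger-sibling relations among pid variables
Guard : Set → ℕ → ℕ → ℕ → Set
Guard D k vp vd =
  (Fin k → ℕ) → (Fin vd → D) → (Fin k ⊎ Fin vp → Fin k ⊎ Fin vp → PRel → Bool) → Bool

record Trans (D : Set) (nS : ℕ) (pty : Fin nS → List⁺ Ty) : Set where
  field
    k m   : ℕ
    m≤k   : m ≤ k
    n     : Fin k → ℕ
    vp vd : ℕ
    inArc  : (s : Fin nS) → List (All (InComp D k vp vd) (toList⁺ (pty s)))
    outArc : (s : Fin nS) → List (All (OutComp D k m n vd) (toList⁺ (pty s)))
    guard  : Guard D k vp vd

record Binding (D : Set) (k vp vd : ℕ) : Set where
  field
    gp : Fin k → Pid
    gc : Fin k → ℕ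
    xp : Fin vp → Pid
    xd : Fin vd → D
    xp-pid : ∀ x → IsPid (xp x)

-- markings: multisets (lists up to permutation) of tokens per place;
-- gen is the generator place s_η (type ℙ × ℕ), ord s the other places
record Marking (D : Set) (nS : ℕ) (pty : Fin nS → List⁺ Ty) : Set where
  constructor mk
  field
    gen : List (Pid × ℕ)
    ord : (s : Fin nS) → List (Tok D (toList⁺ (pty s)))
open Marking public

-- t-nets over data values D ⊇ ℕ (via ι)
record TNet (D : Set) (ι : ℕ → D) : Set where
  field
    nS nT : ℕ
    pty   : Fin nS → List⁺ Ty
    trans : Fin nT → Trans D nS pty
    M0ord : (s : Fin nS) → List (Tok D (toList⁺ (pty s)))
    M0-data : ∀ s → All DataOnly (M0ord s)

data PTree (X : Set) : Set where
  node : X → List (Pid × PTree X) → PTree X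

mark : ∀ {X} → PTree X → X
mark (node M _) = M

kids : ∀ {X} → PTree X → List (Pid × PTree X)
kids (node _ C) = C

-- InTrees π t' t  :⇔  ⟨π , t'⟩ ∈ Trees(t)
data InTrees {X : Set} : Pid → PTree X → PTree X → Set where
  here  : ∀ {t} → InTrees [] t t
  there : ∀ {M C a t π t'} → (a , t) ∈ C → InTrees π t' t → InTrees (a ++ π) t' (node M C)

_∈pid_ : ∀ {X} → Pid → PTree X → Set
π ∈pid t = ∃ λ t' → InTrees π t' t

Unrelated : Pid → Pid → Set
Unrelated a b = a ≢ b × ¬ (a ∈subpid b) × ¬ (b ∈subpid a)

data WF {X : Set} : PTree X → Set where
  node : ∀ {M C} →
         All (λ c → proj₁ c ≢ [] × IsPid (proj₁ c) × WF (proj₂ c)) C →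
         AllPairs Unrelated (map proj₁ C) →
         WF (node M C)

data Incl {X : Set} (_≤X_ : X → X → Set) : PTree X → PTree X → Set where
  node : ∀ {M' M C' C} → M' ≤X M →
         All (λ c' → Any (λ c → proj₁ c' ≡ proj₁ c × Incl _≤X_ (proj₂ c') (proj₂ c)) C) C' →
         Incl _≤X_ (node M' C') (node M C)

data TEq {X : Set} (_≈X_ : X → X → Set) : PTree X → PTree X → Set where
  node : ∀ {M' M C' C} → M' ≈X M →
         Pointwise (λ c' c → proj₁ c' ≡ proj₁ c × TEq _≈X_ (proj₂ c') (proj₂ c)) C' C →
         TEq _≈X_ (node M' C') (node M C)

SiblingOrdered : ∀ {X} → PTree X → Set
SiblingOrdered R = ∀ {π t} → InTrees π t R → Linked _≤H_ (map proj₁ (kids t))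

Expanded : ∀ {X} → PTree X → Set
Expanded R = ∀ {π t} → InTrees π t R → All (λ c → length (proj₁ c) ≡ 1) (kids t)

module _ {D : Set} {ι : ℕ → D} (N : TNet D ι) where
  open TNet N

  Mark : Set
  Mark = Marking D nS pty

  Tree : Set
  Tree = PTree Mark

  M₀ : Mark
  M₀ = mk ((1 ∷ [] , 0) ∷ []) M0ord

  _≈M_ : Mark → Mark → Set
  M ≈M M' = (gen M ↭ gen M') × (∀ s → ord M s ↭ ord M' s)

  _≤M_ : Mark → Mark → Set
  M' ≤M M = (∃ λ r → gen M ↭ gen M' ++ r) × (∀ s → ∃ λ r → ord M s ↭ ord M' s ++ r)

  ∅M : Mark
  ∅M = mk [] (λ _ → [])

  IsEmptyM : Mark → Set
  IsEmptyM M = gen M ≡ [] × (∀ s → ord M s ≡ [])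

  single : (s : Fin nS) → Tok D (toList⁺ (pty s)) → Mark
  single s v = mk [] f
    where
      f : (s' : Fin nS) → List (Tok D (toList⁺ (pty s')))
      f s' with s ≟F s'
      ... | yes refl = v ∷ []
      ... | no _     = []

  module _ (t : Fin nT) where
    open Trans (trans t)

    evalIn : Binding D k vp vd → ∀ {X} → InComp D k vp vd X → Val D X
    evalIn β (genPid i)  = Binding.gp β i
    evalIn β (pidVar x)  = Binding.xp β x
    evalIn β (genCtr i)  = ι (Binding.gc β i)
    evalIn β (dataVar x) = Binding.xd β x
    evalIn β (dataVal d) = d

    evalOut : Binding D k vp vd → ∀ {X} → OutComp D k m n vd X → Val D X
    evalOut β (survivor i) = Binding.gp β (inject≤ i m≤k)
    evalOut β (newPid i j) = Binding.gp β i ∷ʳ (Binding.gc β i + suc (toℕ j))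
    evalOut β (dataExp e)  = e (Binding.gc β) (Binding.xd β)

    evalInV : Binding D k vp vd → ∀ {tys} → All (InComp D k vp vd) tys → Tok D tys
    evalInV β []       = []
    evalInV β (c ∷ cs) = evalIn β c ∷ evalInV β cs

    evalOutV : Binding D k vp vd → ∀ {tys} → All (OutComp D k m n vd) tys → Tok D tys
    evalOutV β []       = []
    evalOutV β (c ∷ cs) = evalOut β c ∷ evalOutV β cs

    -- β(ℓ(s_η, t)) = {⟨p_i , c_i⟩ : i ≤ k}
    genIn : Binding D k vp vd → List (Pid × ℕ)
    genIn β = map (λ i → Binding.gp β i , Binding.gc β i) (allFin k)

    -- β(ℓ(t, s_η)) = {⟨p_i , c_i + n_i⟩ : i ≤ m} ∪ {⟨p_i.(c_i + j) , 0⟩ : i ≤ k, 1 ≤ j ≤ n_i}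
    genOut : Binding D k vp vd → List (Pid × ℕ)
    genOut β =
      map (λ i → Binding.gp β (inject≤ i m≤k) ,
                 Binding.gc β (inject≤ i m≤k) + n (inject≤ i m≤k)) (allFin m)
      ++ concatMap (λ i → map (λ j → (Binding.gp β i ∷ʳ (Binding.gc β i + suc (toℕ j))) , 0)
                              (allFin (n i)))
                   (allFin k)

    pidOf : Binding D k vp vd → Fin k ⊎ Fin vp → Pid
    pidOf β (inj₁ i) = Binding.gp β i
    pidOf β (inj₂ x) = Binding.xp β x

    record Fires (M : Mark) (β : Binding D k vp vd) (M' : Mark) : Set where
      field
        genRest : List (Pid × ℕ)
        genPre  : gen M ↭ genIn β ++ genRest
        genPost : gen M' ↭ genRest ++ genOut β
        rest    : (s : Fin nS) → List (Tok D (toList⁺ (pty s)))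
        pre     : ∀ s → ord M s ↭ map (evalInV β) (inArc s) ++ rest s
        post    : ∀ s → ord M' s ↭ rest s ++ map (evalOutV β) (outArc s)
        guardOK : guard (Binding.gc β) (Binding.xd β)
                        (λ x y r → relB r (pidOf β x) (pidOf β y)) ≡ true

  data Reachable : Mark → Set where
    init : ∀ {M} → M ≈M M₀ → Reachable M
    step : ∀ {M M'} (t : Fin nT) (β : Binding D (Trans.k (trans t)) (Trans.vp (trans t)) (Trans.vd (trans t))) →
           Reachable M → Fires t M β M' → Reachable M'

  IsPath : Pid → Mark → Tree → Set
  IsPath π M' p =
    WF p × π ∈pid p × (∀ {ρ} → ρ ∈pid p → ρ ∈subpid π ⊎ ρ ≡ []) ×
    InTrees π (node M' []) p × (∀ {ρ t} → InTrees ρ t p → ρ ≢ π → IsEmptyM (mark t))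

  ContainsPath : Tree → Pid → Mark → Set
  ContainsPath R π M' = ∃ λ p → IsPath π M' p × Incl _≤M_ p R

  -- node at which a token is decorated: the owner x₁ (owned rule, X₁ = ℙ)
  -- or the root ⟨⟩ (shared rule, X₁ = 𝔻)
  decoLoc : ∀ {X Xs} → Tok D (X ∷ Xs) → Pid
  decoLoc {P}  (x ∷ _) = x
  decoLoc {Dt} _       = []

  Required : Mark → Pid → Set
  Required M π =
    (∃ λ i → (π , i) ∈ gen M) ⊎
    (∃ λ π' → ∃ λ i → (π' , i) ∈ gen M × π ≡ π' ∷ʳ suc i) ⊎
    (Σ (Fin nS) λ s → ∃ λ v → v ∈ ord M s × π ∈ pidComps v)

  placedAt : Mark → Pid → Mark
  placedAt M ρ = mk [] (λ s → filter (λ v → ≡-dec _≟_ (decoLoc v) ρ) (ord M s))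

  record Repr (M : Mark) (R : Tree) : Set where
    field
      pidTree        : WF R
      siblingOrdered : SiblingOrdered R
      generatorRule  : ∀ {π i} → (π , i) ∈ gen M →
                       ContainsPath R π ∅M × ContainsPath R (π ∷ʳ suc i) ∅M
      tokenRule      : ∀ s {v} → v ∈ ord M s →
                       ContainsPath R (decoLoc v) (single s v) ×
                       (∀ {x} → x ∈ pidComps v → ContainsPath R x ∅M)
      noExtraNodes   : ∀ {ρ} → ρ ∈pid R → ρ ≡ [] ⊎ Σ Pid λ π → Required M π × ρ ∈subpid π
      exactTokens    : ∀ {ρ t} → InTrees ρ t R → mark t ≈M placedAt M ρ

  _≈T_ : Tree → Tree → Set
  _≈T_ = TEq _≈M_

-- Existence.  Every pid occurring in a reachable marking lies in ℙ (firing only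
-- copies consumed pids or creates children p.(c+j) with c+j ≥ 1), and the pids
-- demanded by the representation rules form a finite list.  The tree of all
-- initial segments of these pids, the node ρ decorated by the tokens placed at
-- ρ, is computed by a bounded scan (module PrefixTree); it is well formed,
-- sibling ordered and expanded, and contains every required path, so it is a
-- representation of M (module Canonical).
--
-- Uniqueness.  A well-formed, sibling-ordered, expanded tree is determined by
-- its set of nodes and their markings (good-unique): the labels of the children
-- of a node are single entries in strictly increasing order, and a strictly
-- sorted list is determined by its elements (sorted-unique).  An expanded
-- R ∈ repr(M) has the nodes of the canonical tree (it has no extra nodes, and it
-- contains the required paths and is closed under initial segments) and the
-- same markings (exact tokens), hence equals it.
module Submission where

open import Defs
open import Data.Nat using (ℕ; zero; suc; _+_; _<_; _≤_; _≟_; s≤s; z≤n)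
open import Data.Nat.Properties using (<-trans; <-irrefl; <-asym; ≤-trans; <⇒≤; m≤m+n; m≤n+m)
open import Data.List using (List; []; _∷_; _++_; _∷ʳ_; map; length; filter; upTo; concatMap; allFin)
open import Data.List.Extrema.Nat using (max; xs≤max)
open import Data.Fin using (Fin; toℕ) renaming (_≟_ to _≟F_)
open import Data.List.Properties using (++-assoc; ++-identityʳ; ∷-injectiveˡ; ∷-injectiveʳ; length-++; ≡-dec)
open import Data.List.Reverse as Rev using (Reverse; reverseView; _∶_∶ʳ_)
open import Data.List.Relation.Unary.All using (All; []; _∷_)
import Data.List.Relation.Unary.All as All
import Data.List.Relation.Unary.All.Properties as AllP
open import Data.List.Relation.Unary.Any using (Any; here; there; any?)
import Data.List.Relation.Unary.Any as Any
open import Data.List.Relation.Unary.AllPairs using (AllPairs; []; _∷_)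
import Data.List.Relation.Unary.AllPairs as AllPairs
import Data.List.Relation.Unary.AllPairs.Properties as AllPairsP
open import Data.List.Relation.Unary.Linked using (Linked; []; [-]; _∷_)
import Data.List.Relation.Unary.Linked as Linked
open import Data.List.Relation.Unary.Linked.Properties using (Linked⇒AllPairs; AllPairs⇒Linked)
import Data.List.Relation.Unary.Linked.Properties as LinkedP
open import Data.List.Relation.Binary.Pointwise using (Pointwise; []; _∷_)
open import Data.List.Relation.Binary.Subset.Propositional using (_⊆_)
open import Data.List.Membership.Propositional using (_∈_; find; lose)
open import Data.List.Membership.Propositional.Properties
  using (∈-map⁺; ∈-map⁻; ∈-++⁺ˡ; ∈-++⁺ʳ; ∈-++⁻; ∈-concatMap⁺; ∈-concatMap⁻; ∈-allFin; ∈-filter⁺; ∈-filter⁻; ∈-upTo⁺; ∈-∃++)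
open import Data.List.Relation.Binary.Permutation.Propositional using (_↭_; ↭-refl; ↭-sym)
open import Data.List.Relation.Binary.Permutation.Propositional.Properties using (All-resp-↭; shift)
open import Data.Product using (Σ; ∃; _×_; _,_; proj₁; proj₂)
open import Data.Sum using (_⊎_; inj₁; inj₂; [_,_]′)
open import Data.Empty using (⊥-elim)
open import Function using (id)
open import Relation.Nullary using (¬_; Dec; yes; no)
open import Relation.Binary.PropositionalEquality using (_≡_; _≢_; refl; sym; trans; cong; cong₂; subst)
open import Function.Definitions using (Injective)

_≼_ : Pid → Pid → Set
ρ ≼ π = ∃ λ σ → ρ ++ σ ≡ π

-- decidability of ≼ makes the children of a node computable
_≼?_ : (ρ π : Pid) → Dec (ρ ≼ π)
[]      ≼? π       = yes (π , refl)
(x ∷ ρ) ≼? []      = no λ ()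
(x ∷ ρ) ≼? (y ∷ π) with x ≟ y | ρ ≼? π
... | yes refl | yes (σ , e) = yes (σ , cong (x ∷_) e)
... | yes refl | no ρ⋠π      = no λ (σ , e) → ρ⋠π (σ , ∷-injectiveʳ e)
... | no x≢y   | _           = no λ (σ , e) → x≢y (∷-injectiveˡ e)

≼-trans : ∀ {ρ τ π} → ρ ≼ τ → τ ≼ π → ρ ≼ π
≼-trans {ρ} (σ , refl) (σ' , refl) = σ ++ σ' , sym (++-assoc ρ σ σ')

prefix-≼ : ∀ π → prefix π ≼ π
prefix-≼ []          = [] , refl
prefix-≼ (x ∷ [])    = x ∷ [] , refl
prefix-≼ (x ∷ y ∷ π) with σ , e ← prefix-≼ (y ∷ π) = σ , cong (x ∷_) e

prefix-∷ʳ : ∀ π x → prefix (π ∷ʳ x) ≡ π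
prefix-∷ʳ []          x = refl
prefix-∷ʳ (y ∷ [])    x = refl
prefix-∷ʳ (y ∷ z ∷ π) x = cong (y ∷_) (prefix-∷ʳ (z ∷ π) x)

subpid⇒≼ : ∀ {ρ π} → ρ ∈subpid π → ρ ≢ [] × ρ ≼ π
subpid⇒≼ (self refl) = (λ ()) , [] , ++-identityʳ _
subpid⇒≼ {π = x ∷ π} (up ρ∈) with ρ≢[] , ρ≼ ← subpid⇒≼ ρ∈ = ρ≢[] , ≼-trans ρ≼ (prefix-≼ (x ∷ π))

≼⇒subpid : ∀ {ρ π} → ρ ≢ [] → ρ ≼ π → ρ ∈subpid π
≼⇒subpid {[]}     ρ≢[] _           = ⊥-elim (ρ≢[] refl)
≼⇒subpid {r ∷ rs} _    (σ , refl) = extend (reverseView σ)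
  where
    -- induction on σ from its last entry, which prefix removes
    extend : ∀ {σ} → Reverse σ → (r ∷ rs) ∈subpid ((r ∷ rs) ++ σ)
    extend Rev.[]          = self (cong (r ∷_) (sym (++-identityʳ rs)))
    extend (σ ∶ σ-view ∶ʳ x) = up (subst ((r ∷ rs) ∈subpid_) drop-last (extend σ-view))
      where
        drop-last : (r ∷ rs) ++ σ ≡ prefix ((r ∷ rs) ++ σ ∷ʳ x)
        drop-last = sym (trans (cong prefix (sym (++-assoc (r ∷ rs) σ (x ∷ []))))
                               (prefix-∷ʳ ((r ∷ rs) ++ σ) x))

sorted-unique : ∀ {A : Set} {_<_ : A → A → Set} → (∀ {x y} → x < y → ¬ y < x) →
                ∀ {xs ys} → AllPairs _<_ xs → AllPairs _<_ ys → xs ⊆ ys → ys ⊆ xs → xs ≡ ys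
sorted-unique asym []  []  _ _ = refl
sorted-unique asym []  (_ ∷ _) _ ys⊆xs with () ← ys⊆xs (here refl)
sorted-unique asym (_ ∷ _) [] xs⊆ys _ with () ← xs⊆ys (here refl)
sorted-unique {_<_ = _<_} asym {x ∷ xs} {y ∷ ys} (x<xs ∷ xs↑) (y<ys ∷ ys↑) xs⊆ys ys⊆xs =
  cong₂ _∷_ x≡y (sorted-unique asym xs↑ ys↑ tail⊆ tail⊇)
  where
    x≡y : x ≡ y
    x≡y with xs⊆ys (here refl) | ys⊆xs (here refl)
    ... | here x≡y   | _          = x≡y
    ... | there _    | here y≡x   = sym y≡x
    ... | there x∈ys | there y∈xs = ⊥-elim (asym (All.lookup y<ys x∈ys) (All.lookup x<xs y∈xs))
    irrefl : ∀ {z} → ¬ z < z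
    irrefl z<z = asym z<z z<z
    tail⊆ : xs ⊆ ys
    tail⊆ z∈xs with xs⊆ys (there z∈xs)
    ... | there z∈ys = z∈ys
    ... | here refl  = ⊥-elim (irrefl (subst (_< _) x≡y (All.lookup x<xs z∈xs)))
    tail⊇ : ys ⊆ xs
    tail⊇ z∈ys with ys⊆xs (there z∈ys)
    ... | there z∈xs = z∈xs
    ... | here refl  = ⊥-elim (irrefl (subst (_< _) (sym x≡y) (All.lookup y<ys z∈ys)))

-- child labels of an expanded tree are single entries x, ordered by x
IsSingleton : Pid → Set
IsSingleton a = ∃ λ x → a ≡ x ∷ []

length≡1 : ∀ {a : Pid} → length a ≡ 1 → IsSingleton a
length≡1 {x ∷ []} refl = x , refl

firstEntry : Pid → ℕ
firstEntry []      = 0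
firstEntry (x ∷ _) = x

_⊏_ : Pid → Pid → Set
a ⊏ b = firstEntry a < firstEntry b

singleton-< : ∀ {x y} → (x ∷ []) ≤H (y ∷ []) → _≢_ {A = Pid} (x ∷ []) (y ∷ []) → x < y
singleton-< (inj₁ (s≤s ()))
singleton-< (inj₂ (_ , <≤ x<y)) _    = x<y
singleton-< (inj₂ (_ , ≡≤ _))   x≢y = ⊥-elim (x≢y refl)

singleton-unrelated : ∀ {x y} → x < y → Unrelated (x ∷ []) (y ∷ [])
singleton-unrelated x<y =
  (λ e → <-irrefl (∷-injectiveˡ e) x<y) ,
  (λ { (self e) → <-irrefl (∷-injectiveˡ e) x<y ; (up ()) }) ,
  (λ { (self e) → <-irrefl (sym (∷-injectiveˡ e)) x<y ; (up ()) })

singletons-increasing : ∀ {ls} → All IsSingleton ls → Linked _≤H_ ls → AllPairs Unrelated ls → Linked _⊏_ ls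
singletons-increasing []  [] _ = []
singletons-increasing (_ ∷ []) [-] _ = [-]
singletons-increasing ((x , refl) ∷ (y , refl) ∷ ss) (x≤y ∷ ≤H-chain) ((x∤ ∷ _) ∷ unrelated) =
  singleton-< x≤y (proj₁ x∤) ∷ singletons-increasing ((y , refl) ∷ ss) ≤H-chain unrelated

module _ {X : Set} where

  labels : List (Pid × PTree X) → List Pid
  labels = map proj₁

  Good : PTree X → Set
  Good T = WF T × SiblingOrdered T × Expanded T

  SameNodes : PTree X → PTree X → Set
  SameNodes T₁ T₂ = (∀ {ρ} → ρ ∈pid T₁ → ρ ∈pid T₂) × (∀ {ρ} → ρ ∈pid T₂ → ρ ∈pid T₁)

  MarksAgree : (X → X → Set) → PTree X → PTree X → Set
  MarksAgree _≈_ T₁ T₂ = ∀ {ρ t₁ t₂} → InTrees ρ t₁ T₁ → InTrees ρ t₂ T₂ → mark t₁ ≈ mark t₂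

  module _ {M : X} {C : List (Pid × PTree X)} (good : Good (node M C)) where
    private
      wf = proj₁ good
      expanded = proj₂ (proj₂ good)

    good-child : ∀ {a t} → (a , t) ∈ C → Good t
    good-child m with node children-ok _ ← wf =
      proj₂ (proj₂ (All.lookup children-ok m)) ,
      (λ d → proj₁ (proj₂ good) (there m d)) , (λ d → expanded (there m d))

    good-label : ∀ {a t} → (a , t) ∈ C → IsSingleton a
    good-label m = length≡1 (All.lookup (expanded here) m)

    label-unique : ∀ {a t t'} → (a , t) ∈ C → (a , t') ∈ C → t ≡ t'
    label-unique with node _ unrelated ← wf = distinct unrelated
      where
        distinct : ∀ {D a t t'} → AllPairs Unrelated (labels D) → (a , t) ∈ D → (a , t') ∈ D → t ≡ t'
        distinct _         (here refl) (here refl) = refl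
        distinct (a∤ ∷ _)  (here refl) (there m')  = ⊥-elim (proj₁ (All.lookup a∤ (∈-map⁺ proj₁ m')) refl)
        distinct (a∤ ∷ _)  (there m)   (here refl) = ⊥-elim (proj₁ (All.lookup a∤ (∈-map⁺ proj₁ m)) refl)
        distinct (_ ∷ ds)  (there m)   (there m')  = distinct ds m m'

    labels-sorted : AllPairs _⊏_ (labels C)
    labels-sorted with node _ unrelated ← wf =
      Linked⇒AllPairs <-trans
        (singletons-increasing (All.tabulate singleton) (proj₁ (proj₂ good) here) unrelated)
      where
        singleton : ∀ {a} → a ∈ labels C → IsSingleton a
        singleton a∈ with (_ , t) , m , refl ← ∈-map⁻ proj₁ a∈ = good-label m

    child-of : ∀ {π y x ρ} → InTrees π y (node M C) → π ≡ x ∷ ρ →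
               ∃ λ t → (x ∷ [] , t) ∈ C × InTrees ρ y t
    child-of here ()
    child-of (there m d) e with good-label m
    ... | _ , refl with refl ← e = _ , m , d

    descend : ∀ {a t ρ} → (a , t) ∈ C → (a ++ ρ) ∈pid node M C → ρ ∈pid t
    descend m (y , d) with good-label m
    ... | _ , refl with t' , m' , d' ← child-of d refl with refl ← label-unique m m' = y , d'

  same-labels : ∀ {M₁ M₂ C₁ C₂} → Good (node M₁ C₁) → Good (node M₂ C₂) →
                SameNodes (node M₁ C₁) (node M₂ C₂) → labels C₁ ≡ labels C₂
  same-labels g₁ g₂ (to , from) =
    sorted-unique <-asym (labels-sorted g₁) (labels-sorted g₂) (transfer g₁ g₂ to) (transfer g₂ g₁ from)
    where
      transfer : ∀ {M M' C C'} → Good (node M C) → Good (node M' C') →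
                 (∀ {ρ} → ρ ∈pid node M C → ρ ∈pid node M' C') → labels C ⊆ labels C'
      transfer g g' to a∈ with (a , t) , m , refl ← ∈-map⁻ proj₁ a∈ with good-label g m
      ... | x , refl with t' , d ← to (t , there m here) with _ , m' , _ ← child-of g' d refl = ∈-map⁺ proj₁ m'

  same-nodes-below : ∀ {M₁ M₂ C₁ C₂ a t₁ t₂} → Good (node M₁ C₁) → Good (node M₂ C₂) →
                     SameNodes (node M₁ C₁) (node M₂ C₂) → (a , t₁) ∈ C₁ → (a , t₂) ∈ C₂ → SameNodes t₁ t₂
  same-nodes-below g₁ g₂ (to , from) m₁ m₂ =
    (λ (y , d) → descend g₂ m₂ (to (y , there m₁ d))) ,
    (λ (y , d) → descend g₁ m₁ (from (y , there m₂ d)))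

  module _ (_≈_ : X → X → Set) where
    mutual
      good-unique : ∀ {T₁ T₂} → Good T₁ → Good T₂ → SameNodes T₁ T₂ → MarksAgree _≈_ T₁ T₂ → TEq _≈_ T₁ T₂
      good-unique {node _ C₁} {node _ C₂} g₁ g₂ same agree =
        node (agree here here) (children g₁ g₂ same agree C₁ C₂ (λ m → m) (λ m → m) (same-labels g₁ g₂ same))

      children : ∀ {M₁ M₂ C₁ C₂} → Good (node M₁ C₁) → Good (node M₂ C₂) →
                 SameNodes (node M₁ C₁) (node M₂ C₂) → MarksAgree _≈_ (node M₁ C₁) (node M₂ C₂) →
                 (D₁ D₂ : List (Pid × PTree X)) → D₁ ⊆ C₁ → D₂ ⊆ C₂ → labels D₁ ≡ labels D₂ →
                 Pointwise (λ c₁ c₂ → proj₁ c₁ ≡ proj₁ c₂ × TEq _≈_ (proj₂ c₁) (proj₂ c₂)) D₁ D₂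
      children g₁ g₂ same agree [] [] _ _ _ = []
      children g₁ g₂ same agree ((a , t₁) ∷ D₁) ((_ , t₂) ∷ D₂) D₁⊆ D₂⊆ eq with refl ← ∷-injectiveˡ eq =
        (refl , good-unique (good-child g₁ m₁) (good-child g₂ m₂) (same-nodes-below g₁ g₂ same m₁ m₂)
                            (λ d₁ d₂ → agree (there m₁ d₁) (there m₂ d₂)))
        ∷ children g₁ g₂ same agree D₁ D₂ (λ m → D₁⊆ (there m)) (λ m → D₂⊆ (there m)) (∷-injectiveʳ eq)
        where
          m₁ = D₁⊆ (here refl)
          m₂ = D₂⊆ (here refl)

module _ {X : Set} where

  path : X → Pid → X → PTree X
  path e []      M' = node M' []
  path e (a ∷ π) M' = node e ((a ∷ [] , path e π M') ∷ [])

  path-end : ∀ e π M' → InTrees π (node M' []) (path e π M')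
  path-end e []      M' = here
  path-end e (a ∷ π) M' = there (here refl) (path-end e π M')

  path-nodes : ∀ {e π M' ρ t} → InTrees ρ t (path e π M') → ∃ λ σ → ρ ++ σ ≡ π × t ≡ path e σ M'
  path-nodes {π = []}    here = [] , refl , refl
  path-nodes {π = a ∷ π} here = a ∷ π , refl , refl
  path-nodes {π = a ∷ π} (there (here refl) d) with σ , e , t≡ ← path-nodes d = σ , cong (a ∷_) e , t≡

  path-wf : ∀ e {π} M' → IsPid π → WF (path e π M')
  path-wf e M' []         = node [] []
  path-wf e M' (a>0 ∷ π⁺) = node (((λ ()) , a>0 ∷ [] , path-wf e M' π⁺) ∷ []) ([] ∷ [])

  incl-nodes : ∀ {_≤_ : X → X → Set} {p R : PTree X} {π t} → Incl _≤_ p R → InTrees π t p → π ∈pid R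
  incl-nodes {R = R} _ here = R , here
  incl-nodes (node _ included) (there m d)
    with (_ , t') , m' , refl , incl ← find (All.lookup included m) with y , d' ← incl-nodes incl d = y , there m' d'

  prefix-closed : ∀ {R : PTree X} {π t ρ} → Expanded R → InTrees π t R → ρ ≼ π → ρ ∈pid R
  prefix-closed {R} {ρ = []} _ _ _ = R , here
  prefix-closed {ρ = _ ∷ _} ex here (_ , ())
  prefix-closed {ρ = _ ∷ _} ex (there {a = a} m d) (σ , e) with length≡1 {a} (All.lookup (ex here) m)
  ... | _ , refl with refl ← e with y , d' ← prefix-closed (λ d'' → ex (there m d'')) d (σ , refl) = y , there m d'

-- Children of a node are found by scanning 0 … K-1 (all
-- entries of Req are below K), and K also bounds the depth.
module PrefixTree {X : Set} (f : Pid → X) (Req : List Pid) (K : ℕ)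
                  (req-pid : All IsPid Req) (req-small : All (All (_< K)) Req)
                  (req-short : All (λ π → length π ≤ K) Req) where

  Node : Pid → Set
  Node ρ = Any (ρ ≼_) Req

  node? : ∀ ρ → Dec (Node ρ)
  node? ρ = any? (ρ ≼?_) Req

  node-closed : ∀ {ρ σ} → Node (ρ ++ σ) → Node ρ
  node-closed = Any.map (≼-trans (_ , refl))

  node-inherits : ∀ {Q : Pid → Set} → (∀ {ρ σ} → Q (ρ ++ σ) → Q ρ) → All Q Req → ∀ {ρ} → Node ρ → Q ρ
  node-inherits closed all-Q n with _ , π∈ , (_ , refl) ← find n = closed (All.lookup all-Q π∈)

  node-pid : ∀ {ρ} → Node ρ → IsPid ρ
  node-pid = node-inherits (AllP.++⁻ˡ _) req-pid

  node-short : ∀ {ρ} → Node ρ → length ρ ≤ K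
  node-short = node-inherits (λ {ρ} {σ} ≤K → ≤-trans (subst (length ρ ≤_) (sym (length-++ ρ)) (m≤m+n _ _)) ≤K) req-short

  keys : Pid → List ℕ
  keys ρ = filter (λ a → node? (ρ ∷ʳ a)) (upTo K)

  key⇒node : ∀ {ρ a} → a ∈ keys ρ → Node (ρ ∷ʳ a)
  key⇒node {ρ} a∈ = proj₂ (∈-filter⁻ (λ a → node? (ρ ∷ʳ a)) {xs = upTo K} a∈)

  node⇒key : ∀ {ρ a} → Node (ρ ∷ʳ a) → a ∈ keys ρ
  node⇒key {ρ} n with a<K ∷ [] ← AllP.++⁻ʳ ρ (node-inherits (AllP.++⁻ˡ _) req-small n) =
    ∈-filter⁺ (λ a → node? (ρ ∷ʳ a)) (∈-upTo⁺ a<K) n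

  key-positive : ∀ {ρ a} → a ∈ keys ρ → 0 < a
  key-positive {ρ} a∈ with a>0 ∷ [] ← AllP.++⁻ʳ ρ (node-pid (key⇒node a∈)) = a>0

  keys-sorted : ∀ ρ → AllPairs _<_ (keys ρ)
  keys-sorted ρ = AllPairsP.filter⁺ (λ a → node? (ρ ∷ʳ a)) (AllPairsP.applyUpTo⁺₁ id K (λ i<j _ → i<j))

  mutual
    build : ℕ → Pid → PTree X
    build n ρ = node (f ρ) (branches n ρ)

    branches : ℕ → Pid → List (Pid × PTree X)
    branches zero    ρ = []
    branches (suc n) ρ = map (branch n ρ) (keys ρ)

    branch : ℕ → Pid → ℕ → Pid × PTree X
    branch n ρ a = a ∷ [] , build n (ρ ∷ʳ a)

  subtree : ∀ {n ρ π t} → InTrees π t (build n ρ) →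
            (∃ λ m → t ≡ build m (ρ ++ π)) × (π ≡ [] ⊎ Node (ρ ++ π))
  subtree {n} {ρ} here = (n , cong (build n) (sym (++-identityʳ ρ))) , inj₁ refl
  subtree {zero} (there () _)
  subtree {suc n} {ρ} (there {π = π} m d) with a , a∈ , refl ← ∈-map⁻ (branch n ρ) m
    with (k , t≡) , at-node ← subtree {n} d =
    (k , trans t≡ (cong (build k) reassoc)) , inj₂ (subst Node reassoc (below at-node))
    where
      reassoc : (ρ ∷ʳ a) ++ π ≡ ρ ++ (a ∷ π)
      reassoc = ++-assoc ρ (a ∷ []) π
      below : π ≡ [] ⊎ Node ((ρ ∷ʳ a) ++ π) → Node ((ρ ∷ʳ a) ++ π)
      below (inj₁ refl) = subst Node (sym (++-identityʳ (ρ ∷ʳ a))) (key⇒node a∈)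
      below (inj₂ n)    = n

  every-subtree : (Q : PTree X → Set) → (∀ m ρ → Q (build m ρ)) →
                  ∀ {n ρ π t} → InTrees π t (build n ρ) → Q t
  every-subtree Q Q-build {n} d with (m , refl) , _ ← subtree {n} d = Q-build m _

  branches-single : ∀ n ρ → All (λ c → length (proj₁ c) ≡ 1) (branches n ρ)
  branches-single zero    ρ = []
  branches-single (suc n) ρ = AllP.map⁺ (All.universal (λ _ → refl) (keys ρ))

  branches-sorted : ∀ n ρ → Linked _≤H_ (labels (branches n ρ))
  branches-sorted zero    ρ = []
  branches-sorted (suc n) ρ =
    LinkedP.map⁺ (LinkedP.map⁺ (Linked.map (λ a<b → inj₂ (refl , <≤ a<b)) (AllPairs⇒Linked (keys-sorted ρ))))

  build-wf : ∀ n ρ → WF (build n ρ)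
  build-wf zero    ρ = node [] []
  build-wf (suc n) ρ =
    node (AllP.map⁺ (All.tabulate (λ a∈ → (λ ()) , key-positive a∈ ∷ [] , build-wf n _)))
         (AllPairsP.map⁺ (AllPairsP.map⁺ (AllPairs.map singleton-unrelated (keys-sorted ρ))))

  -- the prefix tree itself; its depth bound K covers every node
  tree : PTree X
  tree = build K []

  tree-good : Good tree
  tree-good = build-wf K [] ,
              (λ d → every-subtree (λ t → Linked _≤H_ (labels (kids t))) branches-sorted {K} d) ,
              (λ d → every-subtree (λ t → All (λ c → length (proj₁ c) ≡ 1) (kids t)) branches-single {K} d)

  tree-nodes : ∀ {ρ t} → InTrees ρ t tree → mark t ≡ f ρ × (ρ ≡ [] ⊎ Node ρ)
  tree-nodes d with (_ , refl) , at-node ← subtree {K} d = refl , at-node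

  module _ {_≤X_ : X → X → Set} {e : X} (e-least : ∀ x → e ≤X x) where

    path-included : ∀ n ρ π {M'} → length π ≤ n → Node (ρ ++ π) → M' ≤X f (ρ ++ π) →
                    Incl _≤X_ (path e π M') (build n ρ)
    path-included n ρ [] {M'} _ _ M'≤ = node (subst (M' ≤X_) (cong f (++-identityʳ ρ)) M'≤) []
    path-included zero ρ (a ∷ π) () _ _
    path-included (suc n) ρ (a ∷ π) {M'} (s≤s ≤n) n-node M'≤ =
      node (e-least (f ρ))
           (lose (∈-map⁺ (branch n ρ) (node⇒key (node-closed n-node')))
                 (refl , path-included n (ρ ∷ʳ a) π ≤n n-node' (subst (λ ρ' → M' ≤X f ρ') reassoc M'≤)) ∷ [])
      where
        reassoc : ρ ++ (a ∷ π) ≡ (ρ ∷ʳ a) ++ π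
        reassoc = sym (++-assoc ρ (a ∷ []) π)
        n-node' : Node ((ρ ∷ʳ a) ++ π)
        n-node' = subst Node reassoc n-node

    tree-paths : ∀ {ρ M'} → Node ρ → M' ≤X f ρ → Incl _≤X_ (path e ρ M') tree
    tree-paths n M'≤ = path-included K [] _ (node-short n) n M'≤

bound : List Pid → ℕ
bound L = suc (max 0 (concatMap (λ π → length π ∷ π) L))

below-bound : ∀ {L π x} → π ∈ L → x ∈ length π ∷ π → x < bound L
below-bound π∈ x∈ = s≤s (All.lookup (xs≤max 0 _) (∈-concatMap⁺ (λ π → length π ∷ π) (lose π∈ x∈)))

∈⇒↭∷ : ∀ {A : Set} {x : A} {xs} → x ∈ xs → ∃ λ r → xs ↭ x ∷ r
∈⇒↭∷ {x = x} x∈ with ys , zs , refl ← ∈-∃++ x∈ = ys ++ zs , shift x ys zs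

module _ {D : Set} {ι : ℕ → D} (N : TNet D ι) where
  open TNet N using (nS; nT; M0-data)

  Genuine : Mark N → Set
  Genuine M = All (λ g → IsPid (proj₁ g)) (gen M) × (∀ s → All (λ v → All IsPid (pidComps v)) (ord M s))

  data-only-genuine : ∀ {tys} (v : Tok D tys) → All (_≡ Dt) tys → All IsPid (pidComps v)
  data-only-genuine []      []           = []
  data-only-genuine (_ ∷ v) (refl ∷ dts) = data-only-genuine v dts

  -- Firing only copies consumed pids and creates children p.(c+j) with c+j ≥ 1.
  fire-genuine : ∀ t {β M M'} → Fires N t M β M' → Genuine M → Genuine M'
  fire-genuine t {β} F (gen⁺ , ord⁺) =
    All-resp-↭ (↭-sym genPost) (AllP.++⁺ (proj₂ consumed) out-gen) ,
    λ s → All-resp-↭ (↭-sym (post s)) (AllP.++⁺ (rest-genuine s) (AllP.map⁺ (All.universal out-genuine (outArc s))))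
    where
      open Trans (TNet.trans N t)
      open Fires F
      open Binding β
      consumed = AllP.++⁻ (genIn N t β) (All-resp-↭ genPre gen⁺)
      bound-pid : ∀ i → IsPid (gp i)
      bound-pid i = All.lookup (AllP.map⁻ (proj₁ consumed)) (∈-allFin i)
      new-pid : ∀ i (j : Fin (n i)) → IsPid (gp i ∷ʳ (gc i + suc (toℕ j)))
      new-pid i j = AllP.++⁺ (bound-pid i) (≤-trans (s≤s z≤n) (m≤n+m (suc (toℕ j)) (gc i)) ∷ [])
      out-gen : All (λ g → IsPid (proj₁ g)) (genOut N t β)
      out-gen = AllP.++⁺ (AllP.map⁺ (All.universal (λ i → bound-pid _) (allFin m)))
                         (AllP.concat⁺ (AllP.map⁺ (All.universal (λ i → AllP.map⁺ (All.universal (new-pid i) (allFin (n i)))) (allFin k))))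
      rest-genuine : ∀ s → All (λ v → All IsPid (pidComps v)) (rest s)
      rest-genuine s = AllP.++⁻ʳ (map (evalInV N t β) (inArc s)) (All-resp-↭ (pre s) (ord⁺ s))
      out-genuine : ∀ {tys} (cs : All (OutComp D k m n vd) tys) → All IsPid (pidComps (evalOutV N t β cs))
      out-genuine []                 = []
      out-genuine (survivor i ∷ cs)  = bound-pid _ ∷ out-genuine cs
      out-genuine (newPid i j ∷ cs)  = new-pid i j ∷ out-genuine cs
      out-genuine (dataExp _ ∷ cs)   = out-genuine cs

  reachable-genuine : ∀ {M} → Reachable N M → Genuine M
  reachable-genuine (init (gen≈ , ord≈)) =
    All-resp-↭ (↭-sym gen≈) ((s≤s z≤n ∷ []) ∷ []) ,
    λ s → All-resp-↭ (↭-sym (ord≈ s)) (All.map (λ {v} → data-only-genuine v) (M0-data s))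
  reachable-genuine (step t β r F) = fire-genuine t F (reachable-genuine r)

  ∅-least : ∀ M' → _≤M_ N (∅M N) M'
  ∅-least M' = (gen M' , ↭-refl) , λ s → ord M' s , ↭-refl

  path-is-path : ∀ {π} M' → IsPid π → IsPath N π M' (path (∅M N) π M')
  path-is-path {π} M' π⁺ = path-wf _ M' π⁺ , (_ , path-end _ π M') , along-π , path-end _ π M' , elsewhere-empty
    where
      along-π : ∀ {ρ} → ρ ∈pid path (∅M N) π M' → ρ ∈subpid π ⊎ ρ ≡ []
      along-π {[]}    _      = inj₂ refl
      along-π {_ ∷ _} (_ , d) with σ , e , _ ← path-nodes d = inj₁ (≼⇒subpid (λ ()) (σ , e))
      elsewhere-empty : ∀ {ρ t} → InTrees ρ t (path (∅M N) π M') → ρ ≢ π → IsEmptyM N (mark t)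
      elsewhere-empty {ρ} d ρ≢π with path-nodes d
      ... | []    , e , _    = ⊥-elim (ρ≢π (trans (sym (++-identityʳ ρ)) e))
      ... | _ ∷ _ , _ , refl = refl , λ _ → refl

  path-node : ∀ {R π M'} → ContainsPath N R π M' → π ∈pid R
  path-node (_ , (_ , _ , _ , end , _) , incl) = incl-nodes incl end

  required-paths : ∀ {M R π} → Repr N M R → Required N M π → ContainsPath N R π (∅M N)
  required-paths r (inj₁ (_ , g∈))                 = proj₁ (Repr.generatorRule r g∈)
  required-paths r (inj₂ (inj₁ (_ , _ , g∈ , refl))) = proj₂ (Repr.generatorRule r g∈)
  required-paths r (inj₂ (inj₂ (s , _ , v∈ , x∈)))   = proj₂ (Repr.tokenRule r s v∈) x∈

  owner-or-root : ∀ {X Xs} (v : Tok D (X ∷ Xs)) → decoLoc N v ≡ [] ⊎ decoLoc N v ∈ pidComps v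
  owner-or-root {P}  (_ ∷ _) = inj₂ (here refl)
  owner-or-root {Dt} _       = inj₁ refl

  token-placed : ∀ {M s v} → v ∈ ord M s → _≤M_ N (single N s v) (placedAt N M (decoLoc N v))
  token-placed {M} {s} {v} v∈ = ([] , ↭-refl) , placed
    where
      placed : ∀ s' → ∃ λ r → ord (placedAt N M (decoLoc N v)) s' ↭ ord (single N s v) s' ++ r
      placed s' with s ≟F s'
      ... | yes refl = ∈⇒↭∷ (∈-filter⁺ (λ w → ≡-dec _≟_ (decoLoc N w) (decoLoc N v)) v∈ refl)
      ... | no _     = _ , ↭-refl

  generatorChild : Pid × ℕ → Pid
  generatorChild (π , i) = π ∷ʳ suc i

  required : Mark N → List Pid
  required M = map proj₁ (gen M) ++ map generatorChild (gen M) ++ tokenPids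
    where tokenPids = concatMap (λ s → concatMap pidComps (ord M s)) (allFin nS)

  required⁺ : ∀ {M π} → Required N M π → π ∈ required M
  required⁺ {M} (inj₁ (_ , g∈)) = ∈-++⁺ˡ (∈-map⁺ proj₁ g∈)
  required⁺ {M} (inj₂ (inj₁ (_ , _ , g∈ , refl))) =
    ∈-++⁺ʳ (map proj₁ (gen M)) (∈-++⁺ˡ (∈-map⁺ generatorChild g∈))
  required⁺ {M} (inj₂ (inj₂ (s , _ , v∈ , x∈))) =
    ∈-++⁺ʳ (map proj₁ (gen M)) (∈-++⁺ʳ (map generatorChild (gen M))
      (∈-concatMap⁺ _ (lose (∈-allFin s) (∈-concatMap⁺ pidComps (lose v∈ x∈)))))

  required⁻ : ∀ {M π} → π ∈ required M → Required N M π
  required⁻ {M} π∈ with ∈-++⁻ (map proj₁ (gen M)) π∈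
  ... | inj₁ π∈gen with (_ , i) , g∈ , refl ← ∈-map⁻ proj₁ π∈gen = inj₁ (i , g∈)
  ... | inj₂ π∈rest with ∈-++⁻ (map generatorChild (gen M)) π∈rest
  ...   | inj₁ π∈child with (π' , i) , g∈ , refl ← ∈-map⁻ generatorChild π∈child = inj₂ (inj₁ (π' , i , g∈ , refl))
  ...   | inj₂ π∈tok
          with s , _ , π∈s ← find (∈-concatMap⁻ (λ s → concatMap pidComps (ord M s)) {xs = allFin nS} π∈tok)
          with v , v∈ , π∈v ← find (∈-concatMap⁻ pidComps π∈s) = inj₂ (inj₂ (s , v , v∈ , π∈v))

  required-genuine : ∀ {M π} → Genuine M → Required N M π → IsPid π
  required-genuine (gen⁺ , _) (inj₁ (_ , g∈)) = All.lookup gen⁺ g∈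
  required-genuine (gen⁺ , _) (inj₂ (inj₁ (_ , _ , g∈ , refl))) = AllP.++⁺ (All.lookup gen⁺ g∈) (s≤s z≤n ∷ [])
  required-genuine (_ , ord⁺) (inj₂ (inj₂ (s , _ , v∈ , x∈))) = All.lookup (All.lookup (ord⁺ s) v∈) x∈

module Canonical {D : Set} {ι : ℕ → D} (N : TNet D ι) (M : Mark N) (genuine : Genuine N M) where

  open PrefixTree (placedAt N M) (required N M) (bound (required N M))
         (All.tabulate (λ π∈ → required-genuine N genuine (required⁻ N π∈)))
         (All.tabulate (λ π∈ → All.tabulate (λ x∈ → below-bound π∈ (there x∈))))
         (All.tabulate (λ π∈ → <⇒≤ (below-bound π∈ (here refl))))
    public

  required-node : ∀ {π} → Required N M π → Node π
  required-node req = lose (required⁺ N req) ([] , ++-identityʳ _)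

  node-required : ∀ {ρ} → Node ρ → ρ ≡ [] ⊎ Σ Pid λ π → Required N M π × ρ ∈subpid π
  node-required {[]}    _ = inj₁ refl
  node-required {_ ∷ _} n with π , π∈ , ρ≼π ← find n = inj₂ (π , required⁻ N π∈ , ≼⇒subpid (λ ()) ρ≼π)

  contains : ∀ {ρ M'} → Node ρ → _≤M_ N M' (placedAt N M ρ) → ContainsPath N tree ρ M'
  contains n M'≤ = _ , path-is-path N _ (node-pid n) , tree-paths (∅-least N) n M'≤

  contains-root : ∀ {M'} → _≤M_ N M' (placedAt N M []) → ContainsPath N tree [] M'
  contains-root M'≤ = _ , path-is-path N _ [] , node M'≤ []

  decorated : ∀ s {v} → v ∈ ord M s → ContainsPath N tree (decoLoc N v) (single N s v)
  decorated s {v} v∈ with owner-or-root N v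
  ... | inj₁ at-root = subst (λ ρ → ContainsPath N tree ρ (single N s v)) (sym at-root)
                             (contains-root (subst (λ ρ → _≤M_ N (single N s v) (placedAt N M ρ)) at-root (token-placed N {M} v∈)))
  ... | inj₂ owned   = contains (required-node (inj₂ (inj₂ (s , v , v∈ , owned)))) (token-placed N {M} v∈)

  tree-marks : ∀ {ρ t} → InTrees ρ t tree → mark t ≡ placedAt N M ρ
  tree-marks d = proj₁ (tree-nodes d)

  tree-repr : Repr N M tree
  tree-repr = record
    { pidTree        = proj₁ tree-good
    ; siblingOrdered = proj₁ (proj₂ tree-good)
    ; generatorRule  = λ g∈ → contains (required-node (inj₁ (_ , g∈))) (∅-least N _) ,
                              contains (required-node (inj₂ (inj₁ (_ , _ , g∈ , refl)))) (∅-least N _)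
    ; tokenRule      = λ s {v} v∈ → decorated s v∈ ,
                              λ x∈ → contains (required-node (inj₂ (inj₂ (s , v , v∈ , x∈)))) (∅-least N _)
    ; noExtraNodes   = λ (_ , d) → [ inj₁ , node-required ]′ (proj₂ (tree-nodes d))
    ; exactTokens    = λ {ρ} d → subst (λ m → _≈M_ N m (placedAt N M ρ)) (sym (tree-marks d)) (↭-refl , λ _ → ↭-refl)
    }

  tree-unique : ∀ {R} → Repr N M R → Expanded R → _≈T_ N R tree
  tree-unique {R} r expanded =
    good-unique (_≈M_ N) (Repr.pidTree r , Repr.siblingOrdered r , expanded) tree-good (to , from) agree
    where
      to : ∀ {ρ} → ρ ∈pid R → ρ ∈pid tree
      to ρ∈R with Repr.noExtraNodes r ρ∈R
      ... | inj₁ refl = tree , here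
      ... | inj₂ (π , req , ρ∈π) with _ , ρ≼π ← subpid⇒≼ ρ∈π =
        path-node N (contains (lose (required⁺ N req) ρ≼π) (∅-least N _))
      from : ∀ {ρ} → ρ ∈pid tree → ρ ∈pid R
      from (_ , d) with proj₂ (tree-nodes d)
      ... | inj₁ refl = R , here
      ... | inj₂ n with _ , π∈ , ρ≼π ← find n with _ , d' ← path-node N (required-paths N r (required⁻ N π∈)) =
        prefix-closed expanded d' ρ≼π
      agree : MarksAgree (_≈M_ N) R tree
      agree {ρ} {t₁} d₁ d₂ = subst (_≈M_ N (mark t₁)) (sym (tree-marks d₂)) (Repr.exactTokens r d₁)

proposition4 : (D : Set) (ι : ℕ → D) → Injective _≡_ _≡_ ι →
    (N : TNet D ι) (M : Mark N) → Reachable N M →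
    Σ (Tree N) (λ R → (Repr N M R × Expanded R) ×
      ((R' : Tree N) → Repr N M R' → Expanded R' → _≈T_ N R' R))
proposition4 D ι _ N M reachable =
  tree , (tree-repr , proj₂ (proj₂ tree-good)) , λ _ → tree-unique
  where open Canonical N M (reachable-genuine N reachable)
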